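{- Let $k \ge 2$ be an integer and let $D$ be a $k$-quasi-transitive digraph. If $S_1$ and $S_2$ are distinct strong components of $D$ such that some vertex of $S_1$ has a directed path to some vertex of $S_2$, then $d(u,v) \le k-1$ for every $u \in V(S_1)$ and every $v \in V(S_2)$.
   Context: All digraphs are finite, without loops and without multiple arcs in the same direction; paths are directed. For $u,v \in V(D)$, $d(u,v)$ is the length of a shortest directed $uv$-path ($\infty$ if none). $D$ is $k$-quasi-transitive if for every directed path $(v_0, \dots, v_k)$ of length $k$, $(v_0,v_k) \in A(D)$ or $(v_k,v_0) \in A(D)$. A strong component is a maximal strongly connected subdigraph. -}

module Defs where

open import Data.Nat using (ℕ; zero; suc; _≤_; _∸_)
open import Data.Fin using (Fin)
open import Data.Vec using (Vec; lookup; head; last)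
open import Data.Fin using (inject₁; suc)
open import Data.Product using (Σ; _×_; ∃; ∃-syntax; _,_)
open import Data.Sum using (_⊎_)
open import Data.Empty using (⊥)
open import Data.Unit using (⊤)
open import Relation.Nullary using (¬_)
open import Relation.Binary.PropositionalEquality using (_≡_)
open import Level using (0ℓ)

record Digraph : Set₁ where
  field
    n       : ℕ
    Arc     : Fin n → Fin n → Set
    loopless : ∀ v → ¬ Arc v v

open Digraph public

Vertex : Digraph → Set
Vertex D = Fin (n D)

VSet : Digraph → Set₁
VSet D = Vertex D → Set

IsWalk : (D : Digraph) {m : ℕ} → Vec (Vertex D) (suc m) → Set
IsWalk D {m} vs = (i : Fin m) → Arc D (lookup vs (inject₁ i)) (lookup vs (suc i))

IsPath : (D : Digraph) {m : ℕ} → Vec (Vertex D) (suc m) → Set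
IsPath D {m} vs = IsWalk D vs × (∀ i j → lookup vs i ≡ lookup vs j → i ≡ j)

PathIn : (D : Digraph) → VSet D → ℕ → Vertex D → Vertex D → Set
PathIn D S m u v = Σ (Vec (Vertex D) (suc m)) λ vs →
  IsPath D vs × head vs ≡ u × last vs ≡ v × (∀ i → S (lookup vs i))

Path : (D : Digraph) → ℕ → Vertex D → Vertex D → Set
Path D m u v = PathIn D (λ _ → ⊤) m u v

Dist≤ : (D : Digraph) → Vertex D → Vertex D → ℕ → Set
Dist≤ D u v b = ∃[ m ] (m ≤ b × Path D m u v)

Reaches : (D : Digraph) → Vertex D → Vertex D → Set
Reaches D u v = ∃[ m ] Path D m u v

KQuasiTransitive : ℕ → Digraph → Set
KQuasiTransitive k D = ∀ (vs : Vec (Vertex D) (suc k)) → IsPath D vs →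
  Arc D (head vs) (last vs) ⊎ Arc D (last vs) (head vs)

StronglyConnected : (D : Digraph) → VSet D → Set
StronglyConnected D S = (∃[ v ] S v) × (∀ u v → S u → S v → ∃[ m ] PathIn D S m u v)

Sub : (D : Digraph) → VSet D → VSet D → Set
Sub D S T = ∀ v → S v → T v

StrongComponent : (D : Digraph) → VSet D → Set₁
StrongComponent D S = StronglyConnected D S ×
  (∀ (T : VSet D) → Sub D S T → StronglyConnected D T → Sub D T S)

-- If v could reach u, then u and v would be mutually reachable; the class of
-- vertices mutually reachable with u is strongly connected, so by maximality it
-- would equal both S₁ and S₂. Hence it suffices that in a k-quasi-transitive
-- digraph (k ≥ 2) every pair u ⇝ v with v ̸⇝ u has d(u,v) ≤ k − 1. Take a u–v
-- path x₀ … x_m with m ≥ k. The k-quasi-transitivity of x₀ … x_k gives either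
-- the shortcut x₀ → x_k, or an arc x_k → x₀; in the latter case either x₁ … x_m
-- can itself be shortened, or x_m reaches x₁, hence x_k, hence x₀ = u.
module Submission where

open import Defs
open import Data.Nat using (ℕ; zero; suc; _+_; _≤_; _<_; _∸_; z≤n; s≤s; _≤?_)
open import Data.Nat.Properties using (≤-refl; ≤-trans; <-≤-trans; m≤n⇒m≤1+n; m≤n+m; ≰⇒>; m+[n∸m]≡n; +-suc)
open import Data.Nat.Induction using (<-wellFounded)
open import Induction.WellFounded using (Acc; acc)
open import Data.Fin using (zero; suc; _≟_)
open import Data.Vec using (Vec; []; _∷_; lookup; head; last)
open import Data.Product using (Σ-syntax; _×_; ∃-syntax; _,_; proj₂)
open import Data.Sum using (_⊎_; inj₁; inj₂; [_,_]′)
open import Data.Empty using (⊥-elim)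
open import Data.Unit using (⊤; tt)
open import Function using (id)
open import Relation.Nullary using (¬_; yes; no)
open import Relation.Binary.PropositionalEquality using (_≡_; _≢_; refl; sym; cong; subst₂)

module Walks (D : Digraph) where

  private
    variable
      u v x y z : Vertex D
      j l m : ℕ
      P Q S : VSet D

  infixr 5 _◅_
  infixr 5 _++_
  infix  4 _⇝_ _∉_

  data Walk : Vertex D → Vertex D → ℕ → Set where
    ε   : Walk x x 0
    _◅_ : Arc D x y → Walk y z m → Walk x z (suc m)

  _++_ : Walk x y m → Walk y z l → Walk x z (m + l)
  ε       ++ q = q
  (a ◅ p) ++ q = a ◅ (p ++ q)

  All : VSet D → Walk x y m → Set
  All P (ε {x})       = P x
  All P (_◅_ {x} _ p) = P x × All P p

  _∉_ : Vertex D → Walk x y m → Set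
  z ∉ p = All (z ≢_) p

  Distinct : Walk x y m → Set
  Distinct ε             = ⊤
  Distinct (_◅_ {x} _ p) = x ∉ p × Distinct p

  All-universal : (∀ t → P t) → (p : Walk x y m) → All P p
  All-universal P-all ε       = P-all _
  All-universal P-all (_ ◅ p) = P-all _ , All-universal P-all p

  All-map : (∀ {t} → P t → Q t) → (p : Walk x y m) → All P p → All Q p
  All-map f ε       Pp        = f Pp
  All-map f (_ ◅ p) (Px , Pp) = f Px , All-map f p Pp

  All-++⁻ˡ : (p : Walk x y m) {q : Walk y z l} → All P (p ++ q) → All P p
  All-++⁻ˡ ε       {ε}     Pq        = Pq
  All-++⁻ˡ ε       {_ ◅ _} (Py , _)  = Py
  All-++⁻ˡ (_ ◅ p)         (Px , Pp) = Px , All-++⁻ˡ p Pp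

  Distinct-++⁻ˡ : (p : Walk x y m) {q : Walk y z l} → Distinct (p ++ q) → Distinct p
  Distinct-++⁻ˡ ε       _              = tt
  Distinct-++⁻ˡ (_ ◅ p) (x∉pq , pq-ok) = All-++⁻ˡ p x∉pq , Distinct-++⁻ˡ p pq-ok

  splitAt : ∀ i (p : Walk x y (i + j)) →
            ∃[ w ] Σ[ pre ∈ Walk x w i ] Σ[ post ∈ Walk w y j ] pre ++ post ≡ p
  splitAt zero    p       = _ , ε , p , refl
  splitAt (suc i) (a ◅ p) with splitAt i p
  ... | w , pre , post , refl = w , a ◅ pre , post , refl

  _⇝_ : Vertex D → Vertex D → Set
  x ⇝ y = ∃[ m ] Walk x y m

  ⇝-refl : x ⇝ x
  ⇝-refl = 0 , ε

  ⇝-trans : x ⇝ y → y ⇝ z → x ⇝ z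
  ⇝-trans (_ , p) (_ , q) = _ , p ++ q

  arc⇒⇝ : Arc D x y → x ⇝ y
  arc⇒⇝ a = 1 , a ◅ ε

  between : (p : Walk x y m) → All (λ t → x ⇝ t × t ⇝ y) p
  between ε       = ⇝-refl , ⇝-refl
  between (a ◅ p) = (⇝-refl , (_ , a ◅ p)) ,
                    All-map (λ (x₁⇝t , t⇝y) → ⇝-trans (arc⇒⇝ a) x₁⇝t , t⇝y) p (between p)

  Path≤ : VSet D → Vertex D → Vertex D → ℕ → Set
  Path≤ P x y m = Σ[ m′ ∈ ℕ ] m′ ≤ m × Σ[ q ∈ Walk x y m′ ] Distinct q × All P q

  suffixFrom : ∀ z (p : Walk x y m) → Distinct p → All P p → Path≤ P z y m ⊎ z ∉ p
  suffixFrom z (ε {x}) _ Px with z ≟ x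
  ... | yes refl = inj₁ (0 , z≤n , ε , tt , Px)
  ... | no z≢x   = inj₂ z≢x
  suffixFrom z (_◅_ {x} a p) ap-ok@(_ , p-ok) aP@(_ , Pp) with z ≟ x
  ... | yes refl = inj₁ (_ , ≤-refl , a ◅ p , ap-ok , aP)
  ... | no z≢x with suffixFrom z p p-ok Pp
  ...   | inj₁ (m′ , m′≤m , q , rest) = inj₁ (m′ , m≤n⇒m≤1+n m′≤m , q , rest)
  ...   | inj₂ z∉p                    = inj₂ (z≢x , z∉p)

  removeCycles : (p : Walk x y m) → All P p → Path≤ P x y m
  removeCycles ε Px = 0 , z≤n , ε , tt , Px
  removeCycles (_◅_ {x} a p) (Px , Pp) with removeCycles p Pp
  ... | m′ , m′≤m , q , q-ok , Pq with suffixFrom x q q-ok Pq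
  ...   | inj₁ (m″ , m″≤m′ , r , rest) = m″ , m≤n⇒m≤1+n (≤-trans m″≤m′ m′≤m) , r , rest
  ...   | inj₂ x∉q                     = suc m′ , s≤s m′≤m , a ◅ q , (x∉q , q-ok) , (Px , Pq)

  toVec : Walk x y m → Vec (Vertex D) (suc m)
  toVec (ε {x})       = x ∷ []
  toVec (_◅_ {x} _ p) = x ∷ toVec p

  head-toVec : (p : Walk x y m) → head (toVec p) ≡ x
  head-toVec ε       = refl
  head-toVec (_ ◅ _) = refl

  last-toVec : (p : Walk x y m) → last (toVec p) ≡ y
  last-toVec ε           = refl
  last-toVec (_ ◅ ε)     = refl
  last-toVec (_ ◅ b ◅ p) = last-toVec (b ◅ p)

  toVec-isWalk : (p : Walk x y m) → IsWalk D (toVec p)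
  toVec-isWalk (a ◅ ε)     zero    = a
  toVec-isWalk (a ◅ _ ◅ _) zero    = a
  toVec-isWalk (_ ◅ p)     (suc i) = toVec-isWalk p i

  All⇒lookup : (p : Walk x y m) → All P p → ∀ i → P (lookup (toVec p) i)
  All⇒lookup ε       Px        zero    = Px
  All⇒lookup (_ ◅ _) (Px , _)  zero    = Px
  All⇒lookup (_ ◅ p) (_  , Pp) (suc i) = All⇒lookup p Pp i

  toVec-injective : (p : Walk x y m) → Distinct p →
                    ∀ i j → lookup (toVec p) i ≡ lookup (toVec p) j → i ≡ j
  toVec-injective ε       _           zero    zero    _ = refl
  toVec-injective (_ ◅ _) _           zero    zero    _ = refl
  toVec-injective (_ ◅ p) (x∉p , _)   zero    (suc j) e = ⊥-elim (All⇒lookup p x∉p j e)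
  toVec-injective (_ ◅ p) (x∉p , _)   (suc i) zero    e = ⊥-elim (All⇒lookup p x∉p i (sym e))
  toVec-injective (_ ◅ p) (_ , p-ok)  (suc i) (suc j) e = cong suc (toVec-injective p p-ok i j e)

  toVec-isPath : (p : Walk x y m) → Distinct p → IsPath D (toVec p)
  toVec-isPath p p-ok = toVec-isWalk p , toVec-injective p p-ok

  toPathIn : (p : Walk x y m) → Distinct p → All P p → PathIn D P m x y
  toPathIn p p-ok Pp = toVec p , toVec-isPath p p-ok , head-toVec p , last-toVec p , All⇒lookup p Pp

  walk⇒PathIn : (p : Walk x y m) → All P p → ∃[ m′ ] PathIn D P m′ x y
  walk⇒PathIn p Pp with removeCycles p Pp
  ... | m′ , _ , q , q-ok , Pq = m′ , toPathIn q q-ok Pq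

  fromVec : (vs : Vec (Vertex D) (suc m)) → IsWalk D vs → Walk (head vs) (last vs) m
  fromVec (_ ∷ [])     _       = ε
  fromVec (_ ∷ _ ∷ vs) vs-walk = vs-walk zero ◅ fromVec (_ ∷ vs) (λ i → vs-walk (suc i))

  PathIn⇒⇝ : PathIn D S m x y → x ⇝ y
  PathIn⇒⇝ (vs , (vs-walk , _) , refl , refl , _) = _ , fromVec vs vs-walk

  strongComponent⇒⇝ : StrongComponent D S → S x → S y → x ⇝ y
  strongComponent⇒⇝ {S = S} ((_ , connected) , _) x∈S y∈S = PathIn⇒⇝ {S = S} (proj₂ (connected _ _ x∈S y∈S))

  ReachClass : Vertex D → VSet D
  ReachClass u t = u ⇝ t × t ⇝ u

  ReachClass-stronglyConnected : ∀ u → StronglyConnected D (ReachClass u)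
  ReachClass-stronglyConnected u = (u , ⇝-refl , ⇝-refl) , connected
    where
      connected : ∀ a b → ReachClass u a → ReachClass u b → ∃[ m ] PathIn D (ReachClass u) m a b
      connected a b (u⇝a , _ , a→u) ((_ , u→b) , b⇝u) =
        walk⇒PathIn (a→u ++ u→b) (All-map inClass (a→u ++ u→b) (between (a→u ++ u→b)))
        where
          inClass : ∀ {t} → a ⇝ t × t ⇝ b → ReachClass u t
          inClass (a⇝t , t⇝b) = ⇝-trans u⇝a a⇝t , ⇝-trans t⇝b b⇝u

  ∈-strongComponent : StrongComponent D S → S u → u ⇝ z → z ⇝ u → S z
  ∈-strongComponent {S = S} C@(_ , maximal) u∈S u⇝z z⇝u =
    maximal (ReachClass _) S⊆class (ReachClass-stronglyConnected _) _ (u⇝z , z⇝u)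
    where
      S⊆class : Sub D S (ReachClass _)
      S⊆class t t∈S = strongComponent⇒⇝ C u∈S t∈S , strongComponent⇒⇝ C t∈S u∈S

  module _ (j : ℕ) (kqt : KQuasiTransitive (2 + j) D) where

    Shortcut : Vertex D → Vertex D → ℕ → Set
    Shortcut x y m = ∃[ m′ ] m′ < m × Walk x y m′

    kqt-walk : (p : Walk x y (2 + j)) → Distinct p → Arc D x y ⊎ Arc D y x
    kqt-walk p p-ok = subst₂ (λ a b → Arc D a b ⊎ Arc D b a) (head-toVec p) (last-toVec p)
                             (kqt (toVec p) (toVec-isPath p p-ok))

    shortcutOrReturn : ∀ r → 2 + j + r ≡ m → (p : Walk u v m) → Distinct p → Shortcut u v m ⊎ v ⇝ u
    shortcutOrReturn r refl (a ◅ p) (u∉p , p-ok) with splitAt (suc j) p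
    ... | _ , pre , post , refl with kqt-walk (a ◅ pre) (All-++⁻ˡ pre u∉p , Distinct-++⁻ˡ pre p-ok)
    ...   | inj₁ u→w = inj₁ (suc r , s≤s (s≤s (m≤n+m r j)) , u→w ◅ post)
    shortcutOrReturn zero refl (a ◅ _) _ | _ , _ , ε , refl | inj₂ v→u = inj₂ (arc⇒⇝ v→u)
    shortcutOrReturn (suc r) refl (a ◅ _) (_ , p-ok) | _ , pre , post , refl | inj₂ w→u
      with shortcutOrReturn r (sym (+-suc (suc j) r)) (pre ++ post) p-ok
    ... | inj₁ (m′ , m′<m , q) = inj₁ (suc m′ , s≤s m′<m , a ◅ q)
    ... | inj₂ v⇝x₁            = inj₂ (⇝-trans v⇝x₁ (⇝-trans (_ , pre) (arc⇒⇝ w→u)))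

    closeOrReturn′ : Acc _<_ m → Walk u v m → Dist≤ D u v (suc j) ⊎ v ⇝ u
    closeOrReturn′ (acc shorter) p with removeCycles p (All-universal (λ _ → tt) p)
    ... | m′ , m′≤m , q , q-ok , _ with m′ ≤? suc j
    ...   | yes m′≤k-1 = inj₁ (m′ , m′≤k-1 , toPathIn q q-ok (All-universal (λ _ → tt) q))
    ...   | no  m′≰k-1 with shortcutOrReturn (m′ ∸ (2 + j)) (m+[n∸m]≡n (≰⇒> m′≰k-1)) q q-ok
    ...     | inj₁ (_ , m″<m′ , q′) = closeOrReturn′ (shorter (<-≤-trans m″<m′ m′≤m)) q′
    ...     | inj₂ v⇝u              = inj₂ v⇝u

  closeOrReturn : ∀ {k} → 2 ≤ k → KQuasiTransitive k D → u ⇝ v → Dist≤ D u v (k ∸ 1) ⊎ v ⇝ u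
  closeOrReturn (s≤s (s≤s z≤n)) kqt (m , p) = closeOrReturn′ _ kqt (<-wellFounded m) p

mainTheorem14 : (k : ℕ) → 2 ≤ k → (D : Digraph) → KQuasiTransitive k D →
    (S₁ S₂ : VSet D) → StrongComponent D S₁ → StrongComponent D S₂ →
    ¬ (Sub D S₁ S₂ × Sub D S₂ S₁) →
    (∃[ x ] ∃[ y ] (S₁ x × S₂ y × Reaches D x y)) →
    ∀ u v → S₁ u → S₂ v → Dist≤ D u v (k ∸ 1)
mainTheorem14 k 2≤k D kqt S₁ S₂ C₁ C₂ S₁≉S₂ (x , y , x∈S₁ , y∈S₂ , (_ , x→y)) u v u∈S₁ v∈S₂ =
  [ id , (λ v⇝u → ⊥-elim (S₁≉S₂ (S₁⊆S₂ v⇝u , S₂⊆S₁ v⇝u))) ]′ (closeOrReturn 2≤k kqt u⇝v)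
  where
    open Walks D

    u⇝v : u ⇝ v
    u⇝v = ⇝-trans (strongComponent⇒⇝ C₁ u∈S₁ x∈S₁)
            (⇝-trans (PathIn⇒⇝ x→y) (strongComponent⇒⇝ C₂ y∈S₂ v∈S₂))

    S₁⊆S₂ : v ⇝ u → Sub D S₁ S₂
    S₁⊆S₂ v⇝u z z∈S₁ = ∈-strongComponent C₂ v∈S₂
      (⇝-trans v⇝u (strongComponent⇒⇝ C₁ u∈S₁ z∈S₁)) (⇝-trans (strongComponent⇒⇝ C₁ z∈S₁ u∈S₁) u⇝v)

    S₂⊆S₁ : v ⇝ u → Sub D S₂ S₁
    S₂⊆S₁ v⇝u z z∈S₂ = ∈-strongComponent C₁ u∈S₁
      (⇝-trans u⇝v (strongComponent⇒⇝ C₂ v∈S₂ z∈S₂)) (⇝-trans (strongComponent⇒⇝ C₂ z∈S₂ v∈S₂) v⇝u)
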